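{- Let $0<\varepsilon<1$ and let the configuration be as in the context. Then for each point $j\in\mathcal{X}$, $D_{\bar\sigma(j)}\le D_{\sigma(j)}\le\delta(j,\sigma(j))+\delta(j,\sigma^*(j))$ and $D_{\bar\sigma^*(j)}\le D_{\sigma^*(j)}\le\delta(j,\sigma(j))+\delta(j,\sigma^*(j))$.
   Context: $(V,\delta)$ is a metric space and $\mathcal{X}\subseteq V$ is a finite set of points. $\mathcal{O}$ and $\mathcal{S}$ are disjoint finite nonempty sets of centres, each located at a point of $V$; distinct centres of $\mathcal{O}$ are at positive distance, likewise for $\mathcal{S}$. For $i^*\in\mathcal{O}$, $D_{i^*}=\min_{i\in\mathcal{S}}\delta(i^*,i)$; for $i\in\mathcal{S}$, $D_i=\min_{i^*\in\mathcal{O}}\delta(i,i^*)$. Filtering: build $\overline{\mathcal{O}}$ by processing $i^*\in\mathcal{O}$ in nondecreasing order of $D_{i^*}$ (ties arbitrary), starting with $\overline{\mathcal{O}}=\emptyset$: if some already selected $\bar i\in\overline{\mathcal{O}}$ has $\delta(i^*,\bar i)\le\varepsilon D_{i^*}$, set $\eta(i^*)=\bar i$ for such $\bar i$; otherwise set $\eta(i^*)=i^*$ and add $i^*$ to $\overline{\mathcal{O}}$. $\overline{\mathcal{S}}$ and $\eta$ on $\mathcal{S}$ are defined by the same procedure applied to $\mathcal{S}$. For $j\in\mathcal{X}$, $\sigma(j)$ is a centre of $\mathcal{S}$ nearest to $j$, $\sigma^*(j)$ a centre of $\mathcal{O}$ nearest to $j$, $\bar\sigma(j)=\eta(\sigma(j))$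 and $\bar\sigma^*(j)=\eta(\sigma^*(j))$. -}

module Defs where

open import Data.Nat using (ℕ; suc)
open import Data.Fin using (Fin) renaming (_<_ to _<ᶠ_)
open import Data.Fin.Permutation using (Permutation′; _⟨$⟩ʳ_)
open import Data.Product using (Σ; ∃; _×_; _,_)
open import Data.Sum using (_⊎_)
open import Relation.Binary.PropositionalEquality using (_≡_; _≢_)
open import Relation.Binary.Structures using (IsTotalOrder)
open import Relation.Nullary using (¬_)
open import Algebra.Structures using (IsCommutativeRing)

record OrderedField : Set₁ where
  infixl 6 _+_
  infixl 7 _*_
  infix 4 _≤_
  field
    Carrier : Set
    _+_ _*_ : Carrier → Carrier → Carrier
    -_ : Carrier → Carrier
    0# 1# : Carrier
    _≤_ : Carrier → Carrier → Set
    isCommutativeRing : IsCommutativeRing _≡_ _+_ _*_ -_ 0# 1#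
    isTotalOrder : IsTotalOrder _≡_ _≤_
    0≢1 : 0# ≢ 1#
    inverse : ∀ x → x ≢ 0# → ∃ λ y → x * y ≡ 1#
    +-monoˡ-≤ : ∀ {x y} z → x ≤ y → x + z ≤ y + z
    *-nonneg : ∀ {x y} → 0# ≤ x → 0# ≤ y → 0# ≤ x * y

  infix 4 _<_
  _<_ : Carrier → Carrier → Set
  x < y = x ≤ y × x ≢ y

module _ (F : OrderedField) where
  open OrderedField F

  record Metric (V : Set) : Set where
    field
      δ : V → V → Carrier
      δ-nonneg : ∀ x y → 0# ≤ δ x y
      δ-refl : ∀ x → δ x x ≡ 0#
      δ-zero : ∀ x y → δ x y ≡ 0# → x ≡ y
      δ-sym : ∀ x y → δ x y ≡ δ y x
      δ-triangle : ∀ x y z → δ x z ≤ δ x y + δ y z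

  IsMinimum : {n : ℕ} → (Fin (suc n) → Carrier) → Carrier → Set
  IsMinimum f d = (∃ λ s → f s ≡ d) × (∀ s → d ≤ f s)

  IsNearest : {V : Set} → Metric V → {n : ℕ} → (Fin (suc n) → V) → V → Fin (suc n) → Set
  IsNearest M loc x c = ∀ c' → Metric.δ M x (loc c) ≤ Metric.δ M x (loc c')

  IsNondecreasingOrder : {n : ℕ} → (Fin (suc n) → Carrier) → Permutation′ (suc n) → Set
  IsNondecreasingOrder D ord = ∀ a b → a <ᶠ b → D (ord ⟨$⟩ʳ a) ≤ D (ord ⟨$⟩ʳ b)

  -- η is the result of the filtering procedure run along the order ord.
  -- A centre i is selected (in the filtered set) iff η i ≡ i.  When the
  -- centre at position a is processed, the already selected centres are
  -- those at positions b < a with η fixing them.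
  IsFiltering : {V : Set} → Metric V → {n : ℕ} → (Fin (suc n) → V) →
                (Fin (suc n) → Carrier) → Carrier → Permutation′ (suc n) →
                (Fin (suc n) → Fin (suc n)) → Set
  IsFiltering M loc D ε ord η = ∀ a →
    let i = ord ⟨$⟩ʳ a in
      (Σ (Fin (suc _)) λ b → b <ᶠ a × η (ord ⟨$⟩ʳ b) ≡ ord ⟨$⟩ʳ b
          × Metric.δ M (loc i) (loc (ord ⟨$⟩ʳ b)) ≤ ε * D i
          × η i ≡ ord ⟨$⟩ʳ b)
    ⊎ ((∀ b → b <ᶠ a → η (ord ⟨$⟩ʳ b) ≡ ord ⟨$⟩ʳ b
          → ¬ (Metric.δ M (loc i) (loc (ord ⟨$⟩ʳ b)) ≤ ε * D i))
       × η i ≡ i)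

-- Filtering never redirects a centre to one processed after it, and the
-- processing order is by nondecreasing D, so D (η i) ≤ D i.  For the second
-- inequality, D_i ≤ δ(i, i*) ≤ δ(j, i) + δ(j, i*) by the triangle inequality
-- through j; this holds for any pair of centres.
module Submission where

open import Defs
open import Data.Nat using (ℕ; suc)
open import Data.Fin using (Fin)
open import Data.Fin.Permutation using (Permutation′; _⟨$⟩ʳ_; _⟨$⟩ˡ_; inverseʳ)
open import Data.Product using (_×_; _,_)
open import Data.Sum using (inj₁; inj₂)
open import Relation.Binary.PropositionalEquality using (_≢_; sym; subst)
open import Relation.Binary.Structures using (IsTotalOrder)
open import Algebra.Structures using (IsCommutativeRing)

module _ (F : OrderedField) where
  open OrderedField F
  open IsTotalOrder isTotalOrder using (refl; trans)

  module _ {V : Set} (M : Metric F V) where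
    open Metric M

    δ-triangle-from : ∀ x y z → δ y z ≤ δ x y + δ x z
    δ-triangle-from x y z = subst (λ d → δ y z ≤ d + δ x z) (δ-sym y x) (δ-triangle y x z)

    minimum≤δ-sum : ∀ {n} {p d} {loc : Fin (suc n) → V} →
                    IsMinimum F (λ b → δ p (loc b)) d →
                    ∀ x b → d ≤ δ x p + δ x (loc b)
    minimum≤δ-sum {p = p} {loc = loc} (_ , d≤) x b = trans (d≤ b) (δ-triangle-from x p (loc b))

    filtering-decreases : ∀ {n} (loc : Fin (suc n) → V) (D : Fin (suc n) → Carrier)
                          ε ord η → IsNondecreasingOrder F D ord →
                          IsFiltering F M loc D ε ord η → ∀ i → D (η i) ≤ D i
    filtering-decreases loc D ε ord η nondecreasing filtering i =
      subst (λ i → D (η i) ≤ D i) (inverseʳ ord) (decreases-at (ord ⟨$⟩ˡ i))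
      where
      decreases-at : ∀ a → D (η (ord ⟨$⟩ʳ a)) ≤ D (ord ⟨$⟩ʳ a)
      decreases-at a with filtering a
      ... | inj₁ (b , b<a , _ , _ , η≡b) =
        subst (λ c → D c ≤ D (ord ⟨$⟩ʳ a)) (sym η≡b) (nondecreasing b a b<a)
      ... | inj₂ (_ , η≡id) = subst (λ c → D c ≤ D (ord ⟨$⟩ʳ a)) (sym η≡id) refl

lemma5 : (F : OrderedField) → let open OrderedField F in
    {V : Set} (M : Metric F V) → let open Metric M in
    (m s k : ℕ)
    (locO : Fin (suc m) → V) (locS : Fin (suc s) → V)
    (O-distinct : ∀ i i' → i ≢ i' → 0# < δ (locO i) (locO i'))
    (S-distinct : ∀ i i' → i ≢ i' → 0# < δ (locS i) (locS i'))
    (X : Fin k → V)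
    (ε : Carrier) → 0# < ε → ε < 1# →
    (DO : Fin (suc m) → Carrier) →
    (∀ i → IsMinimum F (λ i' → δ (locO i) (locS i')) (DO i)) →
    (DS : Fin (suc s) → Carrier) →
    (∀ i → IsMinimum F (λ i' → δ (locS i) (locO i')) (DS i)) →
    (ordO : Permutation′ (suc m)) → IsNondecreasingOrder F DO ordO →
    (ηO : Fin (suc m) → Fin (suc m)) → IsFiltering F M locO DO ε ordO ηO →
    (ordS : Permutation′ (suc s)) → IsNondecreasingOrder F DS ordS →
    (ηS : Fin (suc s) → Fin (suc s)) → IsFiltering F M locS DS ε ordS ηS →
    (σ : Fin k → Fin (suc s)) → (∀ j → IsNearest F M locS (X j) (σ j)) →
    (σ* : Fin k → Fin (suc m)) → (∀ j → IsNearest F M locO (X j) (σ* j)) →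
    ∀ j →
    (DS (ηS (σ j)) ≤ DS (σ j)
    × DS (σ j) ≤ δ (X j) (locS (σ j)) + δ (X j) (locO (σ* j)))
    × (DO (ηO (σ* j)) ≤ DO (σ* j)
    × DO (σ* j) ≤ δ (X j) (locS (σ j)) + δ (X j) (locO (σ* j)))
lemma5 F M m s k locO locS _ _ X ε _ _ DO DO-min DS DS-min ordO ordO-mono ηO ηO-filters
       ordS ordS-mono ηS ηS-filters σ _ σ* _ j =
    ( filtering-decreases F M locS DS ε ordS ηS ordS-mono ηS-filters (σ j)
    , minimum≤δ-sum F M (DS-min (σ j)) (X j) (σ* j))
  , ( filtering-decreases F M locO DO ε ordO ηO ordO-mono ηO-filters (σ* j)
    , subst (DO (σ* j) ≤_) (+-comm _ _) (minimum≤δ-sum F M (DO-min (σ* j)) (X j) (σ j)))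
  where
  open OrderedField F using (_≤_)
  open IsCommutativeRing (OrderedField.isCommutativeRing F) using (+-comm)
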